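{- Let $G=(V,E,\beta)$ be a temporal graph and $u\in V$. Then \[ b_u=\sum_{s\in V\setminus\{u\}}\Big(\sum_{e\in E^{\mathrm h}_u}b_{s,e}-\chi_{s,u}\Big). \]
   Context: A temporal graph is $G=(V,E,\beta)$ with $\beta\in\mathbb{N}\cup\{+\infty\}$. A temporal edge $e=(u,v,\tau,\lambda)$ has tail $u$, head $v$, departure time $\tau\in\mathbb{N}$, travel time $\lambda\in\mathbb{N}^+$, arrival time $\mathrm{arr}(e)=\tau+\lambda$. An $st$-walk is a sequence $e_1,\dots,e_k$ of temporal edges $e_i=(u_i,v_i,\tau_i,\lambda_i)$ with $u_1=s$, $v_k=t$, and $u_{i+1}=v_i$, $\mathrm{arr}(e_i)\le\tau_{i+1}\le\mathrm{arr}(e_i)+\beta$ for $i<k$; length $|W|=k$, $\mathrm{arr}(W)=\mathrm{arr}(e_k)$. An $st$-walk $W$ is shortest foremost (SFo) if no $st$-walk $X$ has $\mathrm{arr}(X)<\mathrm{arr}(W)$, or $\mathrm{arr}(X)=\mathrm{arr}(W)$ and $|X|<|W|$. $E^{\mathrm h}_v$ is the set of temporal edges with head $v$. For $s\ne t$ and $e\in E$, $\sigma^*_{s,e,t}$ is the number of SFo $st$-walks containing $e$ and $\sigma^*_{s,t}=\sum_{e\in E^{\mathrm h}_t}\sigma^*_{s,e,t}$. $\chi_{s,t}=1$ if $s\ne t$ and an $st$-walk exists, else $0$. The $s$-SFo betweenness of $e$ is $b_{s,e}=\sum_{t\in V:\chi_{s,t}=1}\sigma^*_{s,e,t}/\sigma^*_{s,t}$.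 For pairwise distinct $s,u,t$, $\sigma^*_{s,u,t}=\sum_{e\in E^{\mathrm h}_u}\sigma^*_{s,e,t}$, and the SFo betweenness of $u$ is $b_u=\sum_{s,t\in V\setminus\{u\}:\chi_{s,t}=1}\sigma^*_{s,u,t}/\sigma^*_{s,t}$. -}

module Defs where

open import Data.Nat using (ℕ; zero; suc; _+_; _≤_; _≤ᵇ_; _<ᵇ_; _≡ᵇ_)
open import Data.Fin using (Fin; _≟_)
open import Data.Bool using (Bool; true; false; _∧_; _∨_; not; if_then_else_)
open import Data.Maybe using (Maybe; just; nothing)
open import Data.List using (List; []; _∷_; map; concatMap; allFin; upTo; length; foldr)
open import Data.Bool.ListAction using (any)
open import Data.Nat.ListAction using (sum)
open import Data.Integer using (+_)
open import Data.Rational using (ℚ; 0ℚ; 1ℚ; _/_) renaming (_+_ to _+ℚ_; _-_ to _-ℚ_)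
open import Relation.Nullary.Decidable using (⌊_⌋)
open import Relation.Binary.PropositionalEquality using (_≡_)

record TEdge (n : ℕ) : Set where
  constructor tedge
  field
    tail head : Fin n
    dep trav  : ℕ

arrE : ∀ {n} → TEdge n → ℕ
arrE e = TEdge.dep e + TEdge.trav e

-- A temporal graph G = (V, E, β): V = Fin n, E = the (injectively indexed,
-- hence a set of) edges edge 0 … edge (m-1), travel times positive,
-- β ∈ ℕ ∪ {+∞} with nothing = +∞.
record TGraph : Set where
  field
    n        : ℕ
    m        : ℕ
    edge     : Fin m → TEdge n
    edge-inj : ∀ i j → edge i ≡ edge j → i ≡ j
    trav-pos : ∀ i → 1 ≤ TEdge.trav (edge i)
    β        : Maybe ℕ

filterᵇ : ∀ {A : Set} → (A → Bool) → List A → List A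
filterᵇ p []       = []
filterᵇ p (x ∷ xs) = if p x then x ∷ filterᵇ p xs else filterᵇ p xs

sumℚ : List ℚ → ℚ
sumℚ = foldr _+ℚ_ 0ℚ

-- a / b as a rational; b = 0 never occurs where used.
frac : ℕ → ℕ → ℚ
frac a zero    = 0ℚ
frac a (suc k) = (+ a) / suc k

module _ (G : TGraph) where
  open TGraph G

  tl hd : Fin m → Fin n
  tl i = TEdge.tail (edge i)
  hd i = TEdge.head (edge i)

  arr : Fin m → ℕ
  arr i = arrE (edge i)

  _==V_ : Fin n → Fin n → Bool
  a ==V b = ⌊ a ≟ b ⌋

  _==E_ : Fin m → Fin m → Bool
  a ==E b = ⌊ a ≟ b ⌋

  waitOK : ℕ → ℕ → Bool
  waitOK a τ with β
  ... | nothing = a ≤ᵇ τ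
  ... | just b  = (a ≤ᵇ τ) ∧ (τ ≤ᵇ a + b)

  consec : Fin m → Fin m → Bool
  consec i j = (hd i ==V tl j) ∧ waitOK (arr i) (TEdge.dep (edge j))

  chain : Fin m → List (Fin m) → Bool
  chain i []       = true
  chain i (j ∷ js) = consec i j ∧ chain j js

  lastE : Fin m → List (Fin m) → Fin m
  lastE i []       = i
  lastE i (j ∷ js) = lastE j js

  isWalk : Fin n → Fin n → List (Fin m) → Bool
  isWalk s t []       = false
  isWalk s t (i ∷ is) = (tl i ==V s) ∧ (hd (lastE i is) ==V t) ∧ chain i is

  -- arrival time of a walk (0 for the empty list, which is never a walk)
  arrW : List (Fin m) → ℕ
  arrW []       = 0
  arrW (i ∷ is) = arr (lastE i is)

  listsOfLen : ℕ → List (List (Fin m))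
  listsOfLen zero    = [] ∷ []
  listsOfLen (suc k) = concatMap (λ l → map (_∷ l) (allFin m)) (listsOfLen k)

  -- all lists of length ≤ m; every walk has length ≤ m (departure times
  -- strictly increase along a walk since travel times are positive)
  candidates : List (List (Fin m))
  candidates = concatMap listsOfLen (upTo (suc m))

  walks : Fin n → Fin n → List (List (Fin m))
  walks s t = filterᵇ (isWalk s t) candidates

  better : List (Fin m) → List (Fin m) → Bool
  better X W = (arrW X <ᵇ arrW W) ∨ ((arrW X ≡ᵇ arrW W) ∧ (length X <ᵇ length W))

  isSFo : Fin n → Fin n → List (Fin m) → Bool
  isSFo s t W = isWalk s t W ∧ not (any (λ X → better X W) (walks s t))

  memE : Fin m → List (Fin m) → Bool
  memE e W = any (e ==E_) W

  σset : Fin n → Fin m → Fin n → ℕ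
  σset s e t = length (filterᵇ (λ W → isSFo s t W ∧ memE e W) candidates)

  Eh : Fin n → List (Fin m)
  Eh v = filterᵇ (λ e → hd e ==V v) (allFin m)

  σst : Fin n → Fin n → ℕ
  σst s t = sum (map (λ e → σset s e t) (Eh t))

  χ : Fin n → Fin n → Bool
  χ s t = not (s ==V t) ∧ any (λ _ → true) (walks s t)

  χℚ : Fin n → Fin n → ℚ
  χℚ s t = if χ s t then 1ℚ else 0ℚ

  bse : Fin n → Fin m → ℚ
  bse s e = sumℚ (map (λ t → frac (σset s e t) (σst s t)) (filterᵇ (χ s) (allFin n)))

  σsut : Fin n → Fin n → Fin n → ℕ
  σsut s u t = sum (map (λ e → σset s e t) (Eh u))

  bu : Fin n → ℚ
  bu u = sumℚ (map (λ s → sumℚ (map (λ t → frac (σsut s u t) (σst s t))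
                      (filterᵇ (λ t → not (t ==V u) ∧ χ s t) (allFin n))))
                 (filterᵇ (λ s → not (s ==V u)) (allFin n)))

  rhs : Fin n → ℚ
  rhs u = sumℚ (map (λ s → sumℚ (map (bse s) (Eh u)) -ℚ χℚ s u)
                 (filterᵇ (λ s → not (s ==V u)) (allFin n)))

{-# OPTIONS --safe #-}

-- Fix a source s. Since the fractions σ*_{s,e,t}/σ*_{s,t} share the denominator σ*_{s,t},
-- exchanging the sums over e ∈ E^h_u and over targets t gives
--   Σ_{e ∈ E^h_u} b_{s,e} = Σ_{t : χ_{s,t} = 1} σ*_{s,u,t}/σ*_{s,t}.
-- This is the s-summand of b_u plus the term t = u, which is σ*_{s,u}/σ*_{s,u} = 1 = χ_{s,u}
-- whenever χ_{s,u} = 1: then σ*_{s,u} > 0, because a walk minimal for the lexicographic order on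
-- (arrival, length) among the finitely many su-walks is shortest foremost.

module Submission where

open import Defs

open import Algebra.Bundles using (CommutativeMonoid)
open import Data.Bool using (Bool; true; false; T; not; _∧_; if_then_else_)
open import Data.Bool.Properties using (T-∧; T-∨)
open import Data.Fin using (Fin; _≟_)
import Data.Integer as ℤ
import Data.Integer.Properties as ℤ
open import Data.Integer.Tactic.RingSolver using (solve-∀)
open import Data.List as List using (List; []; _∷_; map; allFin; length)
open import Data.List.Membership.Propositional using (_∈_; find)
open import Data.List.Membership.Propositional.Properties
  using (∈-filter⁺; ∈-filter⁻; ∈-allFin; ∈-map⁺; ∈-length)
open import Data.List.Properties using (map-cong)
open import Data.List.Relation.Unary.All as All using (All; []; _∷_)
open import Data.List.Relation.Unary.All.Properties using (All¬⇒¬Any)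
open import Data.List.Relation.Unary.AllPairs using (_∷_)
open import Data.List.Relation.Unary.Any as Any using (here; there)
open import Data.List.Relation.Unary.Any.Properties using (any⁺; any⁻)
open import Data.List.Relation.Unary.Unique.Propositional using (Unique)
open import Data.List.Relation.Unary.Unique.Propositional.Properties using (allFin⁺)
open import Data.Nat as ℕ using (ℕ; zero; suc; _≤_; _<_)
open import Data.Nat.ListAction using (sum)
import Data.Nat.Properties as ℕ
open import Data.Product using (∃-syntax; _×_; _,_; proj₁; proj₂)
import Data.Product as Product
open import Data.Product.Relation.Binary.Lex.Strict using (×-strictTotalOrder)
open import Data.Rational using (ℚ; 0ℚ; 1ℚ; _+_; _-_; fromℚᵘ)
open import Data.Rational.Properties
  using (+-identityˡ; +-identityʳ; +-assoc; +-0-commutativeMonoid; +-0-group;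
         toℚᵘ-injective; toℚᵘ-fromℚᵘ; toℚᵘ-homo-+; fromℚᵘ-cong; 0/n≡0)
open import Data.Rational.Unnormalised as ℚᵘ using (mkℚᵘ; _≃_; *≡*)
import Data.Rational.Unnormalised.Properties as ℚᵘ
import Data.Sum as Sum
open import Function using (_∘_; _on_; Equivalence)
open import Level using (0ℓ)
open import Relation.Binary using (Rel; Transitive; Decidable; DecidableEquality; StrictTotalOrder)
open import Relation.Binary.PropositionalEquality
  using (_≡_; refl; sym; trans; cong; subst; _≗_; _≢_; module ≡-Reasoning)
open import Relation.Nullary using (¬_; yes; no; contradiction)
open import Relation.Nullary.Decidable using (⌊_⌋; T?; fromWitness)

open import Algebra.Properties.CommutativeSemigroup
  (CommutativeMonoid.commutativeSemigroup +-0-commutativeMonoid) using (interchange; x∙yz≈y∙xz)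
open import Algebra.Properties.Group +-0-group using (//-rightDividesʳ)

∑ : {A : Set} → List A → (A → ℚ) → ℚ
∑ xs f = sumℚ (map f xs)

syntax ∑ xs (λ x → e) = ∑[ x ∈ xs ] e

module _ {A : Set} where

  ∑-cong : ∀ {f g : A → ℚ} → f ≗ g → ∀ xs → ∑ xs f ≡ ∑ xs g
  ∑-cong f≗g xs = cong sumℚ (map-cong f≗g xs)

  ∑-zero : ∀ (xs : List A) → ∑[ _ ∈ xs ] 0ℚ ≡ 0ℚ
  ∑-zero []       = refl
  ∑-zero (x ∷ xs) = trans (cong (0ℚ +_) (∑-zero xs)) (+-identityˡ 0ℚ)

  ∑-+ : ∀ (f g : A → ℚ) xs → ∑[ x ∈ xs ] (f x + g x) ≡ ∑ xs f + ∑ xs g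
  ∑-+ f g []       = sym (+-identityˡ 0ℚ)
  ∑-+ f g (x ∷ xs) = trans (cong ((f x + g x) +_) (∑-+ f g xs)) (interchange (f x) (g x) _ _)

  ∑-filter-split : ∀ (h : A → ℚ) (q p : A → Bool) xs →
    ∑ (filterᵇ p xs) h ≡
      ∑ (filterᵇ (λ x → not (q x) ∧ p x) xs) h + ∑ (filterᵇ (λ x → q x ∧ p x) xs) h
  ∑-filter-split h q p [] = sym (+-identityˡ 0ℚ)
  ∑-filter-split h q p (x ∷ xs) with p x | q x
  ... | false | false = ∑-filter-split h q p xs
  ... | false | true  = ∑-filter-split h q p xs
  ... | true  | false = trans (cong (h x +_) (∑-filter-split h q p xs)) (sym (+-assoc (h x) _ _))
  ... | true  | true  = trans (cong (h x +_) (∑-filter-split h q p xs))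
                                (x∙yz≈y∙xz (h x) (∑ (filterᵇ (λ x → not (q x) ∧ p x) xs) h) _)

∑-comm : ∀ {A B : Set} (F : A → B → ℚ) xs ys →
  ∑[ x ∈ xs ] ∑[ y ∈ ys ] F x y ≡ ∑[ y ∈ ys ] ∑[ x ∈ xs ] F x y
∑-comm F []       ys = sym (∑-zero ys)
∑-comm F (x ∷ xs) ys = trans (cong (∑ ys (F x) +_) (∑-comm F xs ys))
  (sym (∑-+ (F x) (λ y → ∑[ x ∈ xs ] F x y) ys))

fromℚᵘ-homo-+ : ∀ p q → fromℚᵘ (p ℚᵘ.+ q) ≡ fromℚᵘ p + fromℚᵘ q
fromℚᵘ-homo-+ p q = toℚᵘ-injective (ℚᵘ.≃-trans (toℚᵘ-fromℚᵘ (p ℚᵘ.+ q))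
  (ℚᵘ.≃-sym (ℚᵘ.≃-trans (toℚᵘ-homo-+ (fromℚᵘ p) (fromℚᵘ q))
                        (ℚᵘ.+-cong (toℚᵘ-fromℚᵘ p) (toℚᵘ-fromℚᵘ q)))))

+-common-denominator : ∀ i j k → mkℚᵘ i k ℚᵘ.+ mkℚᵘ j k ≃ mkℚᵘ (i ℤ.+ j) k
+-common-denominator i j k = *≡* (begin
    (i ℤ.* d ℤ.+ j ℤ.* d) ℤ.* d          ≡⟨ distrib i j d ⟩
    (i ℤ.+ j) ℤ.* (d ℤ.* d)              ≡⟨ cong ((i ℤ.+ j) ℤ.*_) (ℤ.pos-* (suc k) (suc k)) ⟨
    (i ℤ.+ j) ℤ.* ℤ.+ (suc k ℕ.* suc k)  ∎)
  where
  open ≡-Reasoning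
  d = ℤ.+ suc k
  distrib : ∀ i j d → (i ℤ.* d ℤ.+ j ℤ.* d) ℤ.* d ≡ (i ℤ.+ j) ℤ.* (d ℤ.* d)
  distrib = solve-∀

frac-0 : ∀ d → frac 0 d ≡ 0ℚ
frac-0 zero    = refl
frac-0 (suc d) = 0/n≡0 (suc d)

frac-+ : ∀ a b d → frac a d + frac b d ≡ frac (a ℕ.+ b) d
frac-+ a b zero    = refl
frac-+ a b (suc k) = trans (sym (fromℚᵘ-homo-+ (mkℚᵘ (ℤ.+ a) k) (mkℚᵘ (ℤ.+ b) k)))
  (fromℚᵘ-cong (+-common-denominator (ℤ.+ a) (ℤ.+ b) k))

frac-self : ∀ {n} → 0 < n → frac n n ≡ 1ℚ
frac-self {suc k} _ = fromℚᵘ-cong {mkℚᵘ (ℤ.+ suc k) k} {mkℚᵘ (ℤ.+ 1) 0} (*≡* (ℤ.*-comm (ℤ.+ suc k) (ℤ.+ 1)))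

∑-frac : ∀ {A : Set} (g : A → ℕ) d xs → ∑[ x ∈ xs ] frac (g x) d ≡ frac (sum (map g xs)) d
∑-frac g d []       = sym (frac-0 d)
∑-frac g d (x ∷ xs) = trans (cong (frac (g x) d +_) (∑-frac g d xs)) (frac-+ (g x) _ d)

∈⇒≤sum : ∀ {n ns} → n ∈ ns → n ≤ sum ns
∈⇒≤sum {ns = n ∷ ns} (here refl)  = ℕ.m≤m+n n (sum ns)
∈⇒≤sum {ns = m ∷ ns} (there n∈ns) = ℕ.m≤n⇒m≤o+n m (∈⇒≤sum n∈ns)

module _ {A : Set} where

  filterᵇ≗filter : ∀ (p : A → Bool) → filterᵇ p ≗ List.filterᵇ p
  filterᵇ≗filter p []       = refl
  filterᵇ≗filter p (x ∷ xs) with p x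
  ... | true  = cong (x ∷_) (filterᵇ≗filter p xs)
  ... | false = filterᵇ≗filter p xs

  ∈-filterᵇ⁺ : ∀ {p : A → Bool} {x xs} → x ∈ xs → T (p x) → x ∈ filterᵇ p xs
  ∈-filterᵇ⁺ {p} {xs = xs} x∈xs px =
    subst (_ ∈_) (sym (filterᵇ≗filter p xs)) (∈-filter⁺ (T? ∘ p) x∈xs px)

  ∈-filterᵇ⁻ : ∀ {p : A → Bool} {x} xs → x ∈ filterᵇ p xs → x ∈ xs × T (p x)
  ∈-filterᵇ⁻ {p} xs x∈ = ∈-filter⁻ (T? ∘ p) (subst (_ ∈_) (filterᵇ≗filter p xs) x∈)

module _ {A : Set} (_≟ᴬ_ : DecidableEquality A) (p : A → Bool) where

  filterᵇ-≟-∉ : ∀ {u ys} → All (u ≢_) ys → filterᵇ (λ t → ⌊ t ≟ᴬ u ⌋ ∧ p t) ys ≡ []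
  filterᵇ-≟-∉ [] = refl
  filterᵇ-≟-∉ {u} {y ∷ _} (u≢y ∷ u∉ys) with y ≟ᴬ u
  ... | yes y≡u = contradiction (sym y≡u) u≢y
  ... | no  _   = filterᵇ-≟-∉ u∉ys

  filterᵇ-≟-Unique : ∀ {u xs} → Unique xs → u ∈ xs →
    filterᵇ (λ t → ⌊ t ≟ᴬ u ⌋ ∧ p t) xs ≡ (if p u then u ∷ [] else [])
  filterᵇ-≟-Unique {u} (u∉ys ∷ _) (here refl) with u ≟ᴬ u
  ... | yes _   = cong (λ ys → if p u then u ∷ ys else ys) (filterᵇ-≟-∉ u∉ys)
  ... | no  u≢u = contradiction refl u≢u
  filterᵇ-≟-Unique {u} {y ∷ _} (y∉ys ∷ ys-unique) (there u∈ys) with y ≟ᴬ u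
  ... | yes y≡u = contradiction y≡u (All.lookup y∉ys u∈ys)
  ... | no  _   = filterᵇ-≟-Unique ys-unique u∈ys

¬T⇒T-not : ∀ {b} → ¬ T b → T (not b)
¬T⇒T-not {false} _   = _
¬T⇒T-not {true}  ¬Tb = ¬Tb _

module _ {A : Set} {ℓ} {_<_ : Rel A ℓ}
         (<-irrefl : ∀ {x} → ¬ x < x) (<-trans : Transitive _<_) (_<?_ : Decidable _<_) where

  ∃-minimal : ∀ {x xs} → x ∈ xs → ∃[ m ] m ∈ xs × All (λ y → ¬ y < m) xs
  ∃-minimal {xs = y ∷ ys} _ = minimal y ys
    where
    minimal : ∀ x xs → ∃[ m ] m ∈ x ∷ xs × All (λ y → ¬ y < m) (x ∷ xs)
    minimal x []       = x , here refl , <-irrefl ∷ []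
    minimal x (y ∷ ys) with minimal y ys
    ... | m , m∈ , m-min with x <? m
    ...   | yes x<m = x , here refl , <-irrefl ∷ All.map (λ y≮m y<x → y≮m (<-trans y<x x<m)) m-min
    ...   | no  x≮m = m , there m∈ , x≮m ∷ m-min

module _ (G : TGraph) where
  open TGraph G

  key : List (Fin m) → ℕ × ℕ
  key W = arrW G W , length W

  module Lex = StrictTotalOrder (×-strictTotalOrder ℕ.<-strictTotalOrder ℕ.<-strictTotalOrder)

  _≺_ : Rel (List (Fin m)) 0ℓ
  _≺_ = Lex._<_ on key

  ≺-irrefl : ∀ {W} → ¬ W ≺ W
  ≺-irrefl = Lex.irrefl (refl , refl)

  ≺-trans : Transitive _≺_
  ≺-trans = Lex.trans

  _≺?_ : Decidable _≺_
  X ≺? W = key X Lex.<? key W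

  better⇒≺ : ∀ X W → T (better G X W) → X ≺ W
  better⇒≺ X W = Sum.map (ℕ.<ᵇ⇒< _ _) (Product.map (ℕ.≡ᵇ⇒≡ _ _) (ℕ.<ᵇ⇒< _ _) ∘ Equivalence.to T-∧)
               ∘ Equivalence.to T-∨

  lastE-∈ : ∀ i is → lastE G i is ∈ i ∷ is
  lastE-∈ i []       = here refl
  lastE-∈ i (j ∷ is) = there (lastE-∈ j is)

  SFo⇒σst-pos : ∀ {s t W} → W ∈ candidates G → T (isSFo G s t W) → 0 < σst G s t
  SFo⇒σst-pos {W = []} _ ()
  SFo⇒σst-pos {s} {t} {i ∷ is} W∈ W-SFo =
    ℕ.<-≤-trans (∈-length W∈σset) (∈⇒≤sum (∈-map⁺ (λ e → σset G s e t) e∈Eh))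
    where
    e = lastE G i is
    W-walk : T (isWalk G s t (i ∷ is))
    W-walk = proj₁ (Equivalence.to T-∧ W-SFo)
    e∈Eh : e ∈ Eh G t
    e∈Eh = ∈-filterᵇ⁺ (∈-allFin e)
      (proj₁ (Equivalence.to T-∧ (proj₂ (Equivalence.to (T-∧ {_==V_ G (tl G i) s}) W-walk))))
    W∈σset : i ∷ is ∈ filterᵇ (λ W → isSFo G s t W ∧ memE G e W) (candidates G)
    W∈σset = ∈-filterᵇ⁺ {p = λ W → isSFo G s t W ∧ memE G e W} W∈
      (Equivalence.from T-∧ (W-SFo , any⁺ _ (Any.map fromWitness (lastE-∈ i is))))

  minimal⇒SFo : ∀ {s t W} → W ∈ walks G s t → All (λ X → ¬ X ≺ W) (walks G s t) →
                T (isSFo G s t W)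
  minimal⇒SFo {s} {t} {W} W∈ W-min = Equivalence.from T-∧
    ( proj₂ (∈-filterᵇ⁻ {p = isWalk G s t} (candidates G) W∈)
    , ¬T⇒T-not (All¬⇒¬Any (All.map (λ {X} X⊀W → X⊀W ∘ better⇒≺ X W) W-min)
                ∘ any⁻ _ (walks G s t)))

  χ⇒σst-pos : ∀ {s t} → T (χ G s t) → 0 < σst G s t
  χ⇒σst-pos {s} {t} χst with find (any⁻ _ (walks G s t) (proj₂ (Equivalence.to T-∧ χst)))
  ... | W , W∈ , _ with ∃-minimal {_<_ = _≺_} (λ {W} → ≺-irrefl {W}) (λ {X Y Z} → ≺-trans {X} {Y} {Z}) _≺?_ W∈
  ...   | M , M∈ , M-min =
    SFo⇒σst-pos (proj₁ (∈-filterᵇ⁻ {p = isWalk G s t} (candidates G) M∈)) (minimal⇒SFo M∈ M-min)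

  σsut/σst : Fin n → Fin n → Fin n → ℚ
  σsut/σst s u t = frac (σsut G s u t) (σst G s t)

  ∑-bse-Eh : ∀ s u → ∑ (Eh G u) (bse G s) ≡ ∑ (filterᵇ (χ G s) (allFin n)) (σsut/σst s u)
  ∑-bse-Eh s u = trans (∑-comm (λ e t → frac (σset G s e t) (σst G s t)) (Eh G u) targets)
    (∑-cong (λ t → ∑-frac (λ e → σset G s e t) (σst G s t) (Eh G u)) targets)
    where targets = filterᵇ (χ G s) (allFin n)

  -- σsut G s u u is σst G s u, so the only term is σ*_{s,u}/σ*_{s,u}.
  ∑-at-u≡χℚ : ∀ s u → ∑ (filterᵇ (λ t → _==V_ G t u ∧ χ G s t) (allFin n)) (σsut/σst s u) ≡ χℚ G s u
  ∑-at-u≡χℚ s u rewrite filterᵇ-≟-Unique _≟_ (χ G s) (allFin⁺ n) (∈-allFin u) with χ G s u in χsu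
  ... | true  = trans (+-identityʳ _) (frac-self (χ⇒σst-pos (subst T (sym χsu) _)))
  ... | false = refl

  ∑-bse-Eh-minus-χ : ∀ s u →
    ∑ (Eh G u) (bse G s) - χℚ G s u ≡ ∑ (filterᵇ (λ t → not (_==V_ G t u) ∧ χ G s t) (allFin n)) (σsut/σst s u)
  ∑-bse-Eh-minus-χ s u = begin
    ∑ (Eh G u) (bse G s) - χℚ G s u
      ≡⟨ cong (_- χℚ G s u) (∑-bse-Eh s u) ⟩
    ∑ (filterᵇ (χ G s) (allFin n)) (σsut/σst s u) - χℚ G s u
      ≡⟨ cong (_- χℚ G s u) (∑-filter-split (σsut/σst s u) (λ t → _==V_ G t u) (χ G s) (allFin n)) ⟩
    (∑-t≠u + ∑-t≡u) - χℚ G s u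
      ≡⟨ cong (λ c → (∑-t≠u + c) - χℚ G s u) (∑-at-u≡χℚ s u) ⟩
    (∑-t≠u + χℚ G s u) - χℚ G s u
      ≡⟨ //-rightDividesʳ (χℚ G s u) ∑-t≠u ⟩
    ∑-t≠u ∎
    where
    open ≡-Reasoning
    ∑-t≠u ∑-t≡u : ℚ
    ∑-t≠u = ∑ (filterᵇ (λ t → not (_==V_ G t u) ∧ χ G s t) (allFin n)) (σsut/σst s u)
    ∑-t≡u = ∑ (filterᵇ (λ t → _==V_ G t u ∧ χ G s t) (allFin n)) (σsut/σst s u)

fact3 : (G : TGraph) (u : Fin (TGraph.n G)) → bu G u ≡ rhs G u
fact3 G u = ∑-cong (λ s → sym (∑-bse-Eh-minus-χ G s u)) (filterᵇ (λ s → not (_==V_ G s u)) (allFin (TGraph.n G)))
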